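{- Let $I \subseteq M$ with $Ann^{2}(I) = I$ and $I \neq M$. Then $I \cap M_{\#} = \emptyset$.
   Context: $M$ is a $C$-algebra (an algebra $\langle M, \vee, \wedge, \neg \rangle$ satisfying the Guzmán–Squier axioms for McCarthy's three-valued logic, embeddable in $\mathbb{3}^X$ with pointwise operations) with nullary operations $T$ (identity for $\wedge$), $F$ (identity for $\vee$), $U$ (fixed point of $\neg$). $M_{\#} = \{ \alpha \in M : \alpha \vee \neg \alpha = T \}$. For $a \in M$, $Ann(a) = \{ \alpha \in M : (\alpha \wedge a) \vee (\neg \alpha \wedge a) = U \}$, and for $S \subseteq M$, $Ann(S) = \bigcap_{a \in S} Ann(a)$; $Ann^2 = Ann \circ Ann$ is a closure operator on subsets of $M$. -}

module Defs where

open import Data.Product using (_×_; Σ)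
open import Relation.Binary.PropositionalEquality using (_≡_)
open import Function.Definitions using (Injective)

-- McCarthy's three-valued logic 𝟛 = {T, F, U} (left-sequential connectives).
data Three : Set where
  t f u : Three

infixr 6 _∧₃_
infixr 5 _∨₃_

¬₃_ : Three → Three
¬₃ t = f
¬₃ f = t
¬₃ u = u

_∧₃_ : Three → Three → Three
t ∧₃ y = y
f ∧₃ y = f
u ∧₃ y = u

_∨₃_ : Three → Three → Three
t ∨₃ y = t
f ∨₃ y = y
u ∨₃ y = u

-- A C-algebra: an algebra ⟨M, ∨, ∧, ¬⟩ embeddable in 𝟛^X (pointwise operations)
-- for some set X, with distinguished constants T, F, U.
record CAlgebra : Set₁ where
  infixr 6 _∧_
  infixr 5 _∨_
  field
    Carrier : Set
    _∨_ : Carrier → Carrier → Carrier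
    _∧_ : Carrier → Carrier → Carrier
    ¬_  : Carrier → Carrier
    T F U : Carrier
    ∧-identityˡ : ∀ x → T ∧ x ≡ x
    ∧-identityʳ : ∀ x → x ∧ T ≡ x
    ∨-identityˡ : ∀ x → F ∨ x ≡ x
    ∨-identityʳ : ∀ x → x ∨ F ≡ x
    ¬U : ¬ U ≡ U
    X : Set
    emb : Carrier → (X → Three)
    emb-injective : ∀ {a b} → (∀ i → emb a i ≡ emb b i) → a ≡ b
    emb-∨ : ∀ a b i → emb (a ∨ b) i ≡ (emb a i ∨₃ emb b i)
    emb-∧ : ∀ a b i → emb (a ∧ b) i ≡ (emb a i ∧₃ emb b i)
    emb-¬ : ∀ a i → emb (¬ a) i ≡ ¬₃ (emb a i)

module _ (M : CAlgebra) where
  open CAlgebra M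

  Subset : Set₁
  Subset = Carrier → Set

  Sharp : Subset
  Sharp α = (α ∨ ¬ α) ≡ T

  Ann₁ : Carrier → Subset
  Ann₁ a α = ((α ∧ a) ∨ (¬ α ∧ a)) ≡ U

  Ann : Subset → Subset
  Ann S α = ∀ a → S a → Ann₁ a α

  Ann² : Subset → Subset
  Ann² S = Ann (Ann S)

  _≐_ : Subset → Subset → Set
  A ≐ B = ∀ x → (A x → B x) × (B x → A x)

-- If α ∈ I is sharp, then at every coordinate α is either two-valued, where
-- (a ∧ α) ∨ (¬a ∧ α) = α forces a = u, or undefined, where T, and hence every
-- element, is undefined too. So Ann(I) ⊆ {U}, and since U annihilates every
-- element, I = Ann²(I) ⊇ Ann({U}) = M.
module Submission where

open import Defs
open import Relation.Nullary using (¬_)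
open import Data.Product using (proj₁)
open import Data.Sum using (_⊎_; inj₁; inj₂)
open import Relation.Binary.PropositionalEquality
open ≡-Reasoning

ann₃ : Three → Three → Three
ann₃ x y = (x ∧₃ y) ∨₃ (¬₃ x ∧₃ y)

¬₃-fixed⇒u : ∀ x → ¬₃ x ≡ x → x ≡ u
¬₃-fixed⇒u u _ = refl

ann₃-zeroʳ : ∀ x → ann₃ x u ≡ u
ann₃-zeroʳ t = refl
ann₃-zeroʳ f = refl
ann₃-zeroʳ u = refl

ann₃≡u⇒ : ∀ x y → ann₃ x y ≡ u → x ≡ u ⊎ y ≡ u
ann₃≡u⇒ t u _ = inj₂ refl
ann₃≡u⇒ f u _ = inj₂ refl
ann₃≡u⇒ u _ _ = inj₁ refl

module _ (M : CAlgebra) where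
  open CAlgebra M renaming (¬_ to ¬ₘ_)

  emb-U : ∀ i → emb U i ≡ u
  emb-U i = ¬₃-fixed⇒u (emb U i) (trans (sym (emb-¬ U i)) (cong (λ z → emb z i) ¬U))

  emb-ann : ∀ a b i → emb ((a ∧ b) ∨ (¬ₘ a ∧ b)) i ≡ ann₃ (emb a i) (emb b i)
  emb-ann a b i = begin
    emb ((a ∧ b) ∨ (¬ₘ a ∧ b)) i                       ≡⟨ emb-∨ (a ∧ b) (¬ₘ a ∧ b) i ⟩
    emb (a ∧ b) i ∨₃ emb (¬ₘ a ∧ b) i                  ≡⟨ cong₂ _∨₃_ (emb-∧ a b i) (emb-∧ (¬ₘ a) b i) ⟩
    (emb a i ∧₃ emb b i) ∨₃ (emb (¬ₘ a) i ∧₃ emb b i)  ≡⟨ cong (λ z → (emb a i ∧₃ emb b i) ∨₃ (z ∧₃ emb b i)) (emb-¬ a i) ⟩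
    ann₃ (emb a i) (emb b i)                           ∎

  Ann₁⇒ann₃≡u : ∀ {a α} → Ann₁ M a α → ∀ i → ann₃ (emb α i) (emb a i) ≡ u
  Ann₁⇒ann₃≡u {a} {α} ann i = begin
    ann₃ (emb α i) (emb a i)         ≡⟨ emb-ann α a i ⟨
    emb ((α ∧ a) ∨ (¬ₘ α ∧ a)) i     ≡⟨ cong (λ z → emb z i) ann ⟩
    emb U i                          ≡⟨ emb-U i ⟩
    u                                ∎

  ann₃≡u⇒Ann₁ : ∀ {a α} → (∀ i → ann₃ (emb α i) (emb a i) ≡ u) → Ann₁ M a α
  ann₃≡u⇒Ann₁ {a} {α} ann = emb-injective λ i → begin
    emb ((α ∧ a) ∨ (¬ₘ α ∧ a)) i     ≡⟨ emb-ann α a i ⟩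
    ann₃ (emb α i) (emb a i)         ≡⟨ ann i ⟩
    u                                ≡⟨ emb-U i ⟨
    emb U i                          ∎

  Ann₁-U : ∀ α → Ann₁ M U α
  Ann₁-U α = ann₃≡u⇒Ann₁ λ i → begin
    ann₃ (emb α i) (emb U i)         ≡⟨ cong (ann₃ (emb α i)) (emb-U i) ⟩
    ann₃ (emb α i) u                 ≡⟨ ann₃-zeroʳ (emb α i) ⟩
    u                                ∎

  emb-T≡u⇒emb≡u : ∀ {i} → emb T i ≡ u → ∀ a → emb a i ≡ u
  emb-T≡u⇒emb≡u {i} T≡u a = begin
    emb a i                          ≡⟨ cong (λ z → emb z i) (∧-identityˡ a) ⟨
    emb (T ∧ a) i                    ≡⟨ emb-∧ T a i ⟩
    emb T i ∧₃ emb a i               ≡⟨ cong (_∧₃ emb a i) T≡u ⟩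
    u                                ∎

  Sharp⇒emb≡u⇒emb-T≡u : ∀ {α i} → Sharp M α → emb α i ≡ u → emb T i ≡ u
  Sharp⇒emb≡u⇒emb-T≡u {α} {i} sharp α≡u = begin
    emb T i                          ≡⟨ cong (λ z → emb z i) sharp ⟨
    emb (α ∨ ¬ₘ α) i                 ≡⟨ emb-∨ α (¬ₘ α) i ⟩
    emb α i ∨₃ emb (¬ₘ α) i          ≡⟨ cong (emb α i ∨₃_) (emb-¬ α i) ⟩
    emb α i ∨₃ ¬₃ emb α i            ≡⟨ cong (λ z → z ∨₃ ¬₃ z) α≡u ⟩
    u                                ∎

  Ann₁-Sharp⇒≡U : ∀ {α a} → Sharp M α → Ann₁ M α a → a ≡ U
  Ann₁-Sharp⇒≡U {α} {a} sharp ann = emb-injective λ i →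
    trans (emb≡u i (ann₃≡u⇒ (emb a i) (emb α i) (Ann₁⇒ann₃≡u ann i))) (sym (emb-U i))
    where
    emb≡u : ∀ i → emb a i ≡ u ⊎ emb α i ≡ u → emb a i ≡ u
    emb≡u i (inj₁ a≡u) = a≡u
    emb≡u i (inj₂ α≡u) = emb-T≡u⇒emb≡u (Sharp⇒emb≡u⇒emb-T≡u sharp α≡u) a

  Ann²-full : ∀ {I α} → I α → Sharp M α → ∀ x → Ann² M I x
  Ann²-full {α = α} Iα sharp x a annIa =
    subst (λ b → Ann₁ M b x) (sym (Ann₁-Sharp⇒≡U sharp (annIa α Iα))) (Ann₁-U x)

proposition4p8 : (M : CAlgebra) → (I : Subset M) →
    _≐_ M (Ann² M I) I →
    ¬ (∀ x → I x) →
    ∀ α → I α → ¬ (Sharp M α)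
proposition4p8 M I Ann²I≐I I≠M α Iα sharp =
  I≠M λ x → proj₁ (Ann²I≐I x) (Ann²-full M Iα sharp x)
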